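{- For every $\epsilon>0$ there exists $n_0$ such that for every $n\ge n_0$ there is a $2$-coloring of the edges of the complete graph on $n$ vertices in which the average size of a monochromatic complete subgraph is at most $(1+\epsilon)\log_2 n$.
   Context: A $2$-coloring of the edges of a complete graph assigns to each edge one of two colors, red or blue. A monochromatic complete subgraph is a set $S$ of vertices (including the empty set and single vertices) such that all edges with both endpoints in $S$ have the same color; they are counted as vertex sets, each set once, and the size of $S$ is $|S|$. The average size is the mean of $|S|$ over all monochromatic complete subgraphs $S$.
   Formalization: The parameter ε ranges over the positive rationals. -}

module Defs where

open import Data.Bool using (Bool; true; false)
open import Data.Bool.Properties using () renaming (_≟_ to _≟ᵇ_)
open import Data.Nat using (ℕ; zero; suc; _+_; _*_; _^_; _≤_)
open import Data.Fin using (Fin; _<_)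
open import Data.Fin.Properties using (all?; _<?_)
open import Data.Fin.Subset using (Subset; _∈_; ∣_∣; inside; outside)
open import Data.Fin.Subset.Properties using (_∈?_)
open import Data.List using (List; []; _∷_; map; _++_; filter; length)
open import Data.Nat.ListAction using (sum)
open import Data.Vec using ([]; _∷_)
open import Data.Product using (Σ; _,_)
open import Data.Sum using (inj₁; inj₂)
open import Relation.Binary.PropositionalEquality using (_≡_)
open import Relation.Nullary using (Dec; yes; no; ¬_)
open import Relation.Nullary.Decidable using (_→-dec_)
open import Data.Rational using (ℚ; ↥_; ↧ₙ_)
import Data.Integer as ℤ

-- The colour of the
-- edge {i,j} with i < j is  c i j ; values c i j with i ≥ j are irrelevant
-- (they are never consulted below).
Colouring : ℕ → Set
Colouring n = Fin n → Fin n → Bool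

AllColoured : ∀ {n} → Colouring n → Subset n → Bool → Set
AllColoured c S b = ∀ i j → i ∈ S → j ∈ S → i < j → c i j ≡ b

-- S spans a monochromatic complete subgraph (empty set and singletons included).
Monochromatic : ∀ {n} → Colouring n → Subset n → Set
Monochromatic c S = Σ Bool (AllColoured c S)

allColoured? : ∀ {n} (c : Colouring n) S b → Dec (AllColoured c S b)
allColoured? c S b =
  all? λ i → all? λ j → (i ∈? S) →-dec ((j ∈? S) →-dec ((i <? j) →-dec (c i j ≟ᵇ b)))

monochromatic? : ∀ {n} (c : Colouring n) S → Dec (Monochromatic c S)
monochromatic? c S with allColoured? c S true | allColoured? c S false
... | yes p | _     = yes (true , p)
... | no _  | yes q = yes (false , q)
... | no p  | no q  = no λ { (true , x) → p x ; (false , x) → q x }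

allSubsets : (n : ℕ) → List (Subset n)
allSubsets zero    = [] ∷ []
allSubsets (suc n) = map (outside ∷_) (allSubsets n) ++ map (inside ∷_) (allSubsets n)

monoSubsets : ∀ {n} → Colouring n → List (Subset n)
monoSubsets {n} c = filter (monochromatic? c) (allSubsets n)

monoCount : ∀ {n} → Colouring n → ℕ
monoCount c = length (monoSubsets c)

monoTotalSize : ∀ {n} → Colouring n → ℕ
monoTotalSize c = sum (map ∣_∣ (monoSubsets c))

-- "average size  ≤ (1+ε) log₂ n"  for ε = a/b > 0 (a = ↥ε, b = ↧ε), stated
-- exactly without reals:  T/C ≤ (1 + a/b) log₂ n
--   ⇔  2^(T b / (C (a+b))) ≤ n  ⇔  2^(T b) ≤ n^(C (a+b)).
AvgMonoSizeAtMost1+εLog₂ : ∀ {n} → ℚ → Colouring n → Set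
AvgMonoSizeAtMost1+εLog₂ {n} ε c =
  2 ^ (monoTotalSize c * ↧ₙ ε) ≤ n ^ (monoCount c * (ℤ.∣ ↥ ε ∣ + ↧ₙ ε))

module Submission where

-- Average over all 2 ^ C(n,2) colourings of K_n.  A fixed k-set S is monochromatic in between D_k
-- and 2 D_k of them, D_k = 2 ^ (C(n,2) - C(k,2)).  With ε = a/b and 2^m ≤ n < 2^(m+1) it suffices to
-- find a colouring with b · (total size) ≤ m (a+b) · (count), and by averaging it suffices that
-- Σ_S b |S| M(S) ≤ Σ_S m (a+b) M(S), where M(S) counts the colourings in which S is monochromatic.
-- Sets with |S| ≤ m satisfy this termwise, those with |S| = m with slack m a D_m.  A set with
-- |S| = k > m overshoots by at most 2 b k D_k; since (k+1) C(n,k+1) D_(k+1) ≤ (n / 2^k) C(n,k) D_k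
-- and n < 2^(m+1), the overshoots decay geometrically from k = m+1, and for m ≥ 8b their total is
-- covered by the slack at size m.

open import Defs
open import Data.Bool using (Bool; true; false)
open import Data.Bool.Properties using () renaming (_≟_ to _≟ᵇ_)
open import Data.Empty using (⊥-elim)
open import Data.Fin using (zero; suc)
open import Data.Fin.Properties using (all?)
open import Data.Fin.Subset using (Subset; _∈_; ∣_∣; inside; outside)
open import Data.Fin.Subset.Properties using (_∈?_; ∣p∣≤n)
import Data.Integer as ℤ
open import Data.List using (List; []; _∷_; map; _++_; filter; length; cartesianProductWith)
open import Data.List.Properties using (map-cong; map-∘; map-++; length-map; length-++)
open import Data.Nat
  using (ℕ; zero; suc; _+_; _*_; _^_; _∸_; _<_; _≤_; z≤n; s≤s; s≤s⁻¹; _≟_; _≤?_; _<?_; >-nonZero)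
open import Data.Nat.Combinatorics using (_C_; nC1≡n; nCk+nC[k+1]≡[n+1]C[k+1])
open import Data.Nat.Combinatorics.Specification using (k>n⇒nCk≡0)
open import Data.Nat.ListAction using (sum)
open import Data.Nat.ListAction.Properties using (sum-++)
open import Data.Nat.Properties
open import Algebra.Properties.CommutativeSemigroup +-commutativeSemigroup using (interchange)
open import Data.Nat.Tactic.RingSolver using (solve-∀)
open import Data.Product using (Σ; ∃-syntax; _×_; _,_; proj₁; proj₂)
open import Data.Rational using (ℚ; mkℚ; 0ℚ; ↥_; ↧ₙ_; positive)
import Data.Rational as ℚ
open import Data.Vec using ([]; _∷_; here; there; lookup)
open import Function using (_∘_)
open import Relation.Binary.PropositionalEquality
open import Relation.Nullary using (Dec; yes; no; ¬_; contradiction)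
open import Relation.Nullary.Decidable using (_→-dec_)
open import Relation.Unary using (Decidable)

private
  variable
    A B E : Set
    P Q R : Set

∑ : List A → (A → ℕ) → ℕ
∑ xs f = sum (map f xs)

infix 5 ∑
syntax ∑ xs (λ x → e) = ∑[ x ∈ xs ] e

∑-++ : ∀ xs ys (f : A → ℕ) → ∑ (xs ++ ys) f ≡ ∑ xs f + ∑ ys f
∑-++ xs ys f = trans (cong sum (map-++ f xs ys)) (sum-++ (map f xs) (map f ys))

∑-map : ∀ (g : A → B) xs f → ∑ (map g xs) f ≡ ∑ xs (f ∘ g)
∑-map g xs f = cong sum (sym (map-∘ xs))

∑-cong : ∀ (xs : List A) {f g} → (∀ x → f x ≡ g x) → ∑ xs f ≡ ∑ xs g
∑-cong xs f≗g = cong sum (map-cong f≗g xs)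

∑-mono : ∀ (xs : List A) {f g} → (∀ x → f x ≤ g x) → ∑ xs f ≤ ∑ xs g
∑-mono []       f≤g = z≤n
∑-mono (x ∷ xs) f≤g = +-mono-≤ (f≤g x) (∑-mono xs f≤g)

∑-+ : ∀ (xs : List A) f g → ∑[ x ∈ xs ] (f x + g x) ≡ ∑ xs f + ∑ xs g
∑-+ []       f g = refl
∑-+ (x ∷ xs) f g = trans (cong (f x + g x +_) (∑-+ xs f g)) (interchange (f x) (g x) _ _)

∑-*ˡ : ∀ (xs : List A) k f → ∑[ x ∈ xs ] (k * f x) ≡ k * ∑ xs f
∑-*ˡ []       k f = sym (*-zeroʳ k)
∑-*ˡ (x ∷ xs) k f = trans (cong (k * f x +_) (∑-*ˡ xs k f)) (sym (*-distribˡ-+ k (f x) _))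

∑-*ʳ : ∀ (xs : List A) k f → ∑[ x ∈ xs ] (f x * k) ≡ ∑ xs f * k
∑-*ʳ xs k f = trans (∑-cong xs (λ x → *-comm (f x) k)) (trans (∑-*ˡ xs k f) (*-comm k _))

∑-const : ∀ (xs : List A) k → ∑[ _ ∈ xs ] k ≡ length xs * k
∑-const []       k = refl
∑-const (x ∷ xs) k = cong (k +_) (∑-const xs k)

∑-zero : ∀ (xs : List A) {f} → (∀ x → f x ≡ 0) → ∑ xs f ≡ 0
∑-zero xs f≗0 = trans (∑-cong xs f≗0) (trans (∑-const xs 0) (*-zeroʳ (length xs)))

∑-swap : ∀ (xs : List A) (ys : List B) (F : A → B → ℕ) →
         ∑[ x ∈ xs ] ∑[ y ∈ ys ] F x y ≡ ∑[ y ∈ ys ] ∑[ x ∈ xs ] F x y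
∑-swap []       ys F = sym (∑-zero ys (λ _ → refl))
∑-swap (x ∷ xs) ys F = trans (cong (∑ ys (F x) +_) (∑-swap xs ys F)) (sym (∑-+ ys (F x) _))

∑-*-∑ : ∀ (xs : List A) (ys : List B) f g →
        ∑[ x ∈ xs ] ∑[ y ∈ ys ] (f x * g y) ≡ ∑ xs f * ∑ ys g
∑-*-∑ xs ys f g = trans (∑-cong xs (λ x → ∑-*ˡ ys (f x) g)) (∑-*ʳ xs (∑ ys g) f)

∑-cartesianProductWith : ∀ (h : A → B → E) xs ys f →
  ∑ (cartesianProductWith h xs ys) f ≡ ∑[ x ∈ xs ] ∑[ y ∈ ys ] f (h x y)
∑-cartesianProductWith h []       ys f = refl
∑-cartesianProductWith h (x ∷ xs) ys f =
  trans (∑-++ (map (h x) ys) _ f)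
        (cong₂ _+_ (∑-map (h x) ys f) (∑-cartesianProductWith h xs ys f))

length-cartesianProductWith : ∀ (h : A → B → E) xs ys →
  length (cartesianProductWith h xs ys) ≡ length xs * length ys
length-cartesianProductWith h []       ys = refl
length-cartesianProductWith h (x ∷ xs) ys =
  trans (length-++ (map (h x) ys))
        (cong₂ _+_ (length-map (h x) ys) (length-cartesianProductWith h xs ys))

∑≤∑⇒∃≤ : ∀ (xs : List A) f g → 0 < length xs → ∑ xs f ≤ ∑ xs g → ∃[ x ] f x ≤ g x
∑≤∑⇒∃≤ (x ∷ xs) f g _ ∑f≤∑g with f x ≤? g x
... | yes fx≤gx = x , fx≤gx
... | no  fx≰gx with xs
...   | []     = ⊥-elim (fx≰gx (subst₂ _≤_ (+-identityʳ (f x)) (+-identityʳ (g x)) ∑f≤∑g))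
...   | y ∷ ys = ∑≤∑⇒∃≤ (y ∷ ys) f g (s≤s z≤n)
                   (+-cancelˡ-≤ (g x) _ _ (≤-trans (+-monoˡ-≤ _ (<⇒≤ (≰⇒> fx≰gx))) ∑f≤∑g))

⟦_⟧ : Dec P → ℕ
⟦ yes _ ⟧ = 1
⟦ no  _ ⟧ = 0

⟦⟧-yes : P → (P? : Dec P) → ⟦ P? ⟧ ≡ 1
⟦⟧-yes p (yes _) = refl
⟦⟧-yes p (no ¬p) = ⊥-elim (¬p p)

⟦⟧-no : ¬ P → (P? : Dec P) → ⟦ P? ⟧ ≡ 0
⟦⟧-no ¬p (yes p) = ⊥-elim (¬p p)
⟦⟧-no ¬p (no _)  = refl

⟦⟧-mono : (P → Q) → (P? : Dec P) (Q? : Dec Q) → ⟦ P? ⟧ ≤ ⟦ Q? ⟧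
⟦⟧-mono P→Q (yes p) Q? = ≤-reflexive (sym (⟦⟧-yes (P→Q p) Q?))
⟦⟧-mono P→Q (no _)  Q? = z≤n

⟦⟧-cong : (P → Q) → (Q → P) → (P? : Dec P) (Q? : Dec Q) → ⟦ P? ⟧ ≡ ⟦ Q? ⟧
⟦⟧-cong P→Q Q→P P? Q? = ≤-antisym (⟦⟧-mono P→Q P? Q?) (⟦⟧-mono Q→P Q? P?)

⟦⟧-× : (R → P × Q) → (P → Q → R) →
       (P? : Dec P) (Q? : Dec Q) (R? : Dec R) → ⟦ R? ⟧ ≡ ⟦ P? ⟧ * ⟦ Q? ⟧
⟦⟧-× R→P×Q P→Q→R (yes p) (yes q) R? = ⟦⟧-yes (P→Q→R p q) R?
⟦⟧-× R→P×Q P→Q→R (yes p) (no ¬q) R? = ⟦⟧-no (¬q ∘ proj₂ ∘ R→P×Q) R?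
⟦⟧-× R→P×Q P→Q→R (no ¬p) Q?      R? = ⟦⟧-no (¬p ∘ proj₁ ∘ R→P×Q) R?

⟦⟧-Σ-Bool : ∀ {P : Bool → Set} (∃P? : Dec (Σ Bool P)) (P₁? : Dec (P true)) (P₀? : Dec (P false)) →
            ⟦ ∃P? ⟧ ≤ ⟦ P₁? ⟧ + ⟦ P₀? ⟧
⟦⟧-Σ-Bool (yes (true  , p)) P₁? P₀? = ≤-trans (≤-reflexive (sym (⟦⟧-yes p P₁?))) (m≤m+n _ _)
⟦⟧-Σ-Bool (yes (false , p)) P₁? P₀? = ≤-trans (≤-reflexive (sym (⟦⟧-yes p P₀?))) (m≤n+m _ _)
⟦⟧-Σ-Bool (no _)            P₁? P₀? = z≤n

module _ {P : A → Set} (P? : Decidable P) where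

  length-filter : ∀ xs → length (filter P? xs) ≡ ∑[ x ∈ xs ] ⟦ P? x ⟧
  length-filter []       = refl
  length-filter (x ∷ xs) with P? x
  ... | yes _ = cong suc (length-filter xs)
  ... | no  _ = length-filter xs

  ∑-filter : ∀ xs g → ∑ (filter P? xs) g ≡ ∑[ x ∈ xs ] (⟦ P? x ⟧ * g x)
  ∑-filter []       g = refl
  ∑-filter (x ∷ xs) g with P? x
  ... | yes _ = cong₂ _+_ (sym (+-identityʳ (g x))) (∑-filter xs g)
  ... | no  _ = ∑-filter xs g

module _ {R : A → B → Set} (R? : ∀ a → Decidable (R a)) (cs : List A) (xs : List B) where

  ∑-∑-filter : ∀ g → ∑[ c ∈ cs ] ∑ (filter (R? c) xs) g ≡ ∑[ x ∈ xs ] (g x * (∑[ c ∈ cs ] ⟦ R? c x ⟧))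
  ∑-∑-filter g = begin
    ∑[ c ∈ cs ] ∑ (filter (R? c) xs) g           ≡⟨ ∑-cong cs (λ c → ∑-filter (R? c) xs g) ⟩
    ∑[ c ∈ cs ] ∑[ x ∈ xs ] (⟦ R? c x ⟧ * g x)   ≡⟨ ∑-swap cs xs _ ⟩
    ∑[ x ∈ xs ] ∑[ c ∈ cs ] (⟦ R? c x ⟧ * g x)   ≡⟨ ∑-cong xs (λ x → ∑-*ʳ cs (g x) (λ c → ⟦ R? c x ⟧)) ⟩
    ∑[ x ∈ xs ] ((∑[ c ∈ cs ] ⟦ R? c x ⟧) * g x) ≡⟨ ∑-cong xs (λ x → *-comm _ (g x)) ⟩
    ∑[ x ∈ xs ] (g x * (∑[ c ∈ cs ] ⟦ R? c x ⟧)) ∎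
    where open ≡-Reasoning

  ∑-length-filter : ∑[ c ∈ cs ] length (filter (R? c) xs) ≡ ∑[ x ∈ xs ] ∑[ c ∈ cs ] ⟦ R? c x ⟧
  ∑-length-filter = trans (∑-cong cs (λ c → length-filter (R? c) xs)) (∑-swap cs xs _)

2^+2^≡2^suc : ∀ k → 2 ^ k + 2 ^ k ≡ 2 ^ suc k
2^+2^≡2^suc k = cong (2 ^ k +_) (sym (+-identityʳ (2 ^ k)))

length-allSubsets : ∀ n → length (allSubsets n) ≡ 2 ^ n
length-allSubsets zero    = refl
length-allSubsets (suc n) = begin
  length (map (outside ∷_) 𝒫 ++ map (inside ∷_) 𝒫) ≡⟨ length-++ (map (outside ∷_) 𝒫) ⟩
  length (map (outside ∷_) 𝒫) + length (map (inside ∷_) 𝒫)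
    ≡⟨ cong₂ _+_ (length-map (outside ∷_) 𝒫) (length-map (inside ∷_) 𝒫) ⟩
  length 𝒫 + length 𝒫                              ≡⟨ cong (λ l → l + l) (length-allSubsets n) ⟩
  2 ^ n + 2 ^ n                                    ≡⟨ 2^+2^≡2^suc n ⟩
  2 ^ suc n                                        ∎
  where
  open ≡-Reasoning
  𝒫 = allSubsets n

∑-allSubsets : ∀ n (f : Subset (suc n) → ℕ) →
  ∑ (allSubsets (suc n)) f ≡ (∑[ S ∈ allSubsets n ] f (outside ∷ S)) + (∑[ S ∈ allSubsets n ] f (inside ∷ S))
∑-allSubsets n f =
  trans (∑-++ (map (outside ∷_) 𝒫) _ f) (cong₂ _+_ (∑-map (outside ∷_) 𝒫 f) (∑-map (inside ∷_) 𝒫 f))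
  where 𝒫 = allSubsets n

ConstantOn : ∀ {n} → Subset n → Bool → Subset n → Set
ConstantOn S b r = ∀ j → j ∈ S → lookup r j ≡ b

constantOn? : ∀ {n} (S : Subset n) b r → Dec (ConstantOn S b r)
constantOn? S b r = all? λ j → (j ∈? S) →-dec (lookup r j ≟ᵇ b)

module _ {n} {S : Subset n} {b : Bool} {r : Subset n} where

  constantOn-tail : ∀ {x y} → ConstantOn (x ∷ S) b (y ∷ r) → ConstantOn S b r
  constantOn-tail const j j∈S = const (suc j) (there j∈S)

  constantOn-outside : ∀ {y} → ConstantOn S b r → ConstantOn (outside ∷ S) b (y ∷ r)
  constantOn-outside const (suc j) (there j∈S) = const j j∈S

  constantOn-inside : ConstantOn S b r → ConstantOn (inside ∷ S) b (b ∷ r)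
  constantOn-inside const zero    here        = refl
  constantOn-inside const (suc j) (there j∈S) = const j j∈S

  ¬constantOn-inside : ∀ {y} → ¬ y ≡ b → ¬ ConstantOn (inside ∷ S) b (y ∷ r)
  ¬constantOn-inside y≢b const = y≢b (const zero here)

module _ {n} (S : Subset n) (b : Bool) where

  ∑-constantOn-cons : ∀ {x y} → (∀ {r} → ConstantOn S b r → ConstantOn (x ∷ S) b (y ∷ r)) →
    ∑[ r ∈ allSubsets n ] ⟦ constantOn? (x ∷ S) b (y ∷ r) ⟧ ≡ ∑[ r ∈ allSubsets n ] ⟦ constantOn? S b r ⟧
  ∑-constantOn-cons lift = ∑-cong (allSubsets n) (λ r → ⟦⟧-cong constantOn-tail lift _ _)

  ∑-constantOn-mismatch : ∀ y → ¬ y ≡ b → ∑[ r ∈ allSubsets n ] ⟦ constantOn? (inside ∷ S) b (y ∷ r) ⟧ ≡ 0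
  ∑-constantOn-mismatch y y≢b = ∑-zero (allSubsets n) (λ r → ⟦⟧-no (¬constantOn-inside y≢b) _)

count-constantOn : ∀ n (S : Subset n) b → ∑[ r ∈ allSubsets n ] ⟦ constantOn? S b r ⟧ ≡ 2 ^ (n ∸ ∣ S ∣)
count-constantOn zero    []      b = refl
count-constantOn (suc n) (outside ∷ S) b = begin
  ∑[ r ∈ allSubsets (suc n) ] ⟦ constantOn? (outside ∷ S) b r ⟧
    ≡⟨ ∑-allSubsets n _ ⟩
  (∑[ r ∈ allSubsets n ] ⟦ constantOn? (outside ∷ S) b (outside ∷ r) ⟧)
    + (∑[ r ∈ allSubsets n ] ⟦ constantOn? (outside ∷ S) b (inside ∷ r) ⟧)
    ≡⟨ cong₂ _+_ (∑-constantOn-cons S b constantOn-outside) (∑-constantOn-cons S b constantOn-outside) ⟩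
  (∑[ r ∈ allSubsets n ] ⟦ constantOn? S b r ⟧) + (∑[ r ∈ allSubsets n ] ⟦ constantOn? S b r ⟧)
    ≡⟨ cong (λ k → k + k) (count-constantOn n S b) ⟩
  2 ^ (n ∸ ∣ S ∣) + 2 ^ (n ∸ ∣ S ∣)
    ≡⟨ 2^+2^≡2^suc (n ∸ ∣ S ∣) ⟩
  2 ^ suc (n ∸ ∣ S ∣)
    ≡⟨ cong (2 ^_) (+-∸-assoc 1 (∣p∣≤n S)) ⟨
  2 ^ (suc n ∸ ∣ S ∣) ∎
  where open ≡-Reasoning
count-constantOn (suc n) (inside ∷ S) false =
  trans (∑-allSubsets n _)
        (trans (cong₂ _+_ (∑-constantOn-cons S false constantOn-inside)
                          (∑-constantOn-mismatch S false true λ ()))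
               (trans (+-identityʳ _) (count-constantOn n S false)))
count-constantOn (suc n) (inside ∷ S) true =
  trans (∑-allSubsets n _)
        (trans (cong₂ _+_ (∑-constantOn-mismatch S true false λ ())
                          (∑-constantOn-cons S true constantOn-inside))
               (count-constantOn n S true))

triangular : ℕ → ℕ
triangular zero    = 0
triangular (suc n) = n + triangular n

triangular-mono : ∀ {k n} → k ≤ n → triangular k ≤ triangular n
triangular-mono {zero}          _         = z≤n
triangular-mono {suc k} {suc n} (s≤s k≤n) = +-mono-≤ k≤n (triangular-mono k≤n)

monoColourings : ℕ → ℕ → ℕ
monoColourings n k = 2 ^ (triangular n ∸ triangular k)

monoColourings-outside : ∀ n k → k ≤ n → monoColourings (suc n) k ≡ 2 ^ n * monoColourings n k
monoColourings-outside n k k≤n =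
  trans (cong (2 ^_) (+-∸-assoc n (triangular-mono k≤n))) (^-distribˡ-+-* 2 n _)

monoColourings-inside : ∀ n k → k ≤ n →
  monoColourings (suc n) (suc k) ≡ 2 ^ (n ∸ k) * monoColourings n k
monoColourings-inside n k k≤n =
  trans (cong (2 ^_) (∸-interchange k≤n (triangular-mono k≤n))) (^-distribˡ-+-* 2 (n ∸ k) _)
  where
  ∸-interchange : ∀ {k n s t} → k ≤ n → t ≤ s → (n + s) ∸ (k + t) ≡ (n ∸ k) + (s ∸ t)
  ∸-interchange {n = n} z≤n t≤s = +-∸-assoc n t≤s
  ∸-interchange (s≤s k≤n) t≤s = ∸-interchange k≤n t≤s

monoColourings-suc : ∀ n k → k < n → monoColourings n k ≡ 2 ^ k * monoColourings n (suc k)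
monoColourings-suc n k k<n = trans (cong (2 ^_) exponent) (^-distribˡ-+-* 2 k _)
  where
  open ≡-Reasoning
  k≤[n]∸[k] : k ≤ triangular n ∸ triangular k
  k≤[n]∸[k] = subst (_≤ triangular n ∸ triangular k) (m+n∸n≡m k (triangular k))
                    (∸-monoˡ-≤ (triangular k) (triangular-mono k<n))
  exponent : triangular n ∸ triangular k ≡ k + (triangular n ∸ triangular (suc k))
  exponent = begin
    triangular n ∸ triangular k               ≡⟨ m+[n∸m]≡n k≤[n]∸[k] ⟨
    k + (triangular n ∸ triangular k ∸ k)     ≡⟨ cong (k +_) (∸-+-assoc (triangular n) (triangular k) k) ⟩
    k + (triangular n ∸ (triangular k + k))
      ≡⟨ cong (λ t → k + (triangular n ∸ t)) (+-comm (triangular k) k) ⟩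
    k + (triangular n ∸ triangular (suc k))   ∎

-- Vertex zero is the new vertex; the row r colours its edges to the old ones.
extend : ∀ {n} → Subset n → Colouring n → Colouring (suc n)
extend r c zero    (suc j) = lookup r j
extend r c (suc i) (suc j) = c i j
extend r c _       zero    = false

colourings : (n : ℕ) → List (Colouring n)
colourings zero    = (λ ()) ∷ []
colourings (suc n) = cartesianProductWith extend (allSubsets n) (colourings n)

length-colourings : ∀ n → length (colourings n) ≡ 2 ^ triangular n
length-colourings zero    = refl
length-colourings (suc n) = begin
  length (cartesianProductWith extend (allSubsets n) (colourings n))
    ≡⟨ length-cartesianProductWith extend (allSubsets n) (colourings n) ⟩
  length (allSubsets n) * length (colourings n)
    ≡⟨ cong₂ _*_ (length-allSubsets n) (length-colourings n) ⟩
  2 ^ n * 2 ^ triangular n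
    ≡⟨ ^-distribˡ-+-* 2 n (triangular n) ⟨
  2 ^ triangular (suc n) ∎
  where open ≡-Reasoning

module _ {n} (r : Subset n) (c : Colouring n) (S : Subset n) (b : Bool) where

  allColoured-outside⁻ : AllColoured (extend r c) (outside ∷ S) b → AllColoured c S b
  allColoured-outside⁻ mono i j i∈S j∈S i<j = mono (suc i) (suc j) (there i∈S) (there j∈S) (s≤s i<j)

  allColoured-outside⁺ : AllColoured c S b → AllColoured (extend r c) (outside ∷ S) b
  allColoured-outside⁺ mono (suc i) (suc j) (there i∈S) (there j∈S) (s≤s i<j) = mono i j i∈S j∈S i<j

  allColoured-inside⁻ : AllColoured (extend r c) (inside ∷ S) b → ConstantOn S b r × AllColoured c S b
  allColoured-inside⁻ mono =
      (λ j j∈S → mono zero (suc j) here (there j∈S) (s≤s z≤n))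
    , (λ i j i∈S j∈S i<j → mono (suc i) (suc j) (there i∈S) (there j∈S) (s≤s i<j))

  allColoured-inside⁺ : ConstantOn S b r → AllColoured c S b → AllColoured (extend r c) (inside ∷ S) b
  allColoured-inside⁺ const mono zero    (suc j) here        (there j∈S) _         = const j j∈S
  allColoured-inside⁺ const mono (suc i) (suc j) (there i∈S) (there j∈S) (s≤s i<j) = mono i j i∈S j∈S i<j

count-allColoured : ∀ n (S : Subset n) b →
  ∑[ c ∈ colourings n ] ⟦ allColoured? c S b ⟧ ≡ monoColourings n ∣ S ∣
count-allColoured zero    []            b = refl
count-allColoured (suc n) (outside ∷ S) b = begin
  ∑[ c ∈ colourings (suc n) ] ⟦ allColoured? c (outside ∷ S) b ⟧
    ≡⟨ ∑-cartesianProductWith extend (allSubsets n) (colourings n) _ ⟩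
  ∑[ r ∈ allSubsets n ] ∑[ c ∈ colourings n ] ⟦ allColoured? (extend r c) (outside ∷ S) b ⟧
    ≡⟨ ∑-cong (allSubsets n) (λ r → ∑-cong (colourings n) λ c →
         ⟦⟧-cong (allColoured-outside⁻ r c S b) (allColoured-outside⁺ r c S b) _ _) ⟩
  ∑[ r ∈ allSubsets n ] ∑[ c ∈ colourings n ] ⟦ allColoured? c S b ⟧
    ≡⟨ ∑-const (allSubsets n) _ ⟩
  length (allSubsets n) * (∑[ c ∈ colourings n ] ⟦ allColoured? c S b ⟧)
    ≡⟨ cong₂ _*_ (length-allSubsets n) (count-allColoured n S b) ⟩
  2 ^ n * monoColourings n ∣ S ∣
    ≡⟨ monoColourings-outside n ∣ S ∣ (∣p∣≤n S) ⟨
  monoColourings (suc n) ∣ S ∣ ∎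
  where open ≡-Reasoning
count-allColoured (suc n) (inside ∷ S) b = begin
  ∑[ c ∈ colourings (suc n) ] ⟦ allColoured? c (inside ∷ S) b ⟧
    ≡⟨ ∑-cartesianProductWith extend (allSubsets n) (colourings n) _ ⟩
  ∑[ r ∈ allSubsets n ] ∑[ c ∈ colourings n ] ⟦ allColoured? (extend r c) (inside ∷ S) b ⟧
    ≡⟨ ∑-cong (allSubsets n) (λ r → ∑-cong (colourings n) λ c →
         ⟦⟧-× (allColoured-inside⁻ r c S b) (allColoured-inside⁺ r c S b)
                (constantOn? S b r) (allColoured? c S b) _) ⟩
  ∑[ r ∈ allSubsets n ] ∑[ c ∈ colourings n ] (⟦ constantOn? S b r ⟧ * ⟦ allColoured? c S b ⟧)
    ≡⟨ ∑-*-∑ (allSubsets n) (colourings n) _ _ ⟩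
  (∑[ r ∈ allSubsets n ] ⟦ constantOn? S b r ⟧) * (∑[ c ∈ colourings n ] ⟦ allColoured? c S b ⟧)
    ≡⟨ cong₂ _*_ (count-constantOn n S b) (count-allColoured n S b) ⟩
  2 ^ (n ∸ ∣ S ∣) * monoColourings n ∣ S ∣
    ≡⟨ monoColourings-inside n ∣ S ∣ (∣p∣≤n S) ⟨
  monoColourings (suc n) (suc ∣ S ∣) ∎
  where open ≡-Reasoning

#monochromatic : ∀ {n} → Subset n → ℕ
#monochromatic {n} S = ∑[ c ∈ colourings n ] ⟦ monochromatic? c S ⟧

monoColourings≤#monochromatic : ∀ {n} (S : Subset n) → monoColourings n ∣ S ∣ ≤ #monochromatic S
monoColourings≤#monochromatic {n} S = subst (_≤ #monochromatic S) (count-allColoured n S true)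
  (∑-mono (colourings n) (λ c → ⟦⟧-mono (true ,_) (allColoured? c S true) (monochromatic? c S)))

#monochromatic≤2*monoColourings : ∀ {n} (S : Subset n) → #monochromatic S ≤ 2 * monoColourings n ∣ S ∣
#monochromatic≤2*monoColourings {n} S = begin
  #monochromatic S
    ≤⟨ ∑-mono (colourings n) (λ c →
         ⟦⟧-Σ-Bool (monochromatic? c S) (allColoured? c S true) (allColoured? c S false)) ⟩
  ∑[ c ∈ colourings n ] (⟦ allColoured? c S true ⟧ + ⟦ allColoured? c S false ⟧)
    ≡⟨ ∑-+ (colourings n) _ _ ⟩
  (∑[ c ∈ colourings n ] ⟦ allColoured? c S true ⟧) + (∑[ c ∈ colourings n ] ⟦ allColoured? c S false ⟧)
    ≡⟨ cong₂ _+_ (count-allColoured n S true) (count-allColoured n S false) ⟩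
  monoColourings n ∣ S ∣ + monoColourings n ∣ S ∣
    ≡⟨ cong (monoColourings n ∣ S ∣ +_) (+-identityʳ _) ⟨
  2 * monoColourings n ∣ S ∣ ∎
  where open ≤-Reasoning

∑< : ℕ → (ℕ → ℕ) → ℕ
∑< zero    f = 0
∑< (suc L) f = f 0 + ∑< L (f ∘ suc)

infix 5 ∑<
syntax ∑< L (λ k → e) = ∑[ k < L ] e

∑<-cong : ∀ L {f g} → (∀ k → f k ≡ g k) → ∑< L f ≡ ∑< L g
∑<-cong zero    f≗g = refl
∑<-cong (suc L) f≗g = cong₂ _+_ (f≗g 0) (∑<-cong L (f≗g ∘ suc))

∑<-+ : ∀ L f g → ∑[ k < L ] (f k + g k) ≡ ∑< L f + ∑< L g
∑<-+ zero    f g = refl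
∑<-+ (suc L) f g = trans (cong (f 0 + g 0 +_) (∑<-+ L (f ∘ suc) (g ∘ suc))) (interchange (f 0) (g 0) _ _)

∑<-zero : ∀ L → ∑[ _ < L ] 0 ≡ 0
∑<-zero zero    = refl
∑<-zero (suc L) = ∑<-zero L

term≤∑< : ∀ L f {j} → j < L → f j ≤ ∑< L f
term≤∑< (suc L) f {zero}  _         = m≤m+n (f 0) _
term≤∑< (suc L) f {suc j} (s≤s j<L) = ≤-trans (term≤∑< L (f ∘ suc) j<L) (m≤n+m _ (f 0))

∑<-geometric : ∀ L j f → (∀ k → k < j → f k ≡ 0) → (∀ k → j ≤ k → 2 * f (suc k) ≤ f k) →
               ∑< L f ≤ 2 * f j
∑<-geometric zero    j       f _     _     = z≤n
∑<-geometric (suc L) (suc j) f below decay rewrite below 0 (s≤s z≤n) =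
  ∑<-geometric L j (f ∘ suc) (λ k k<j → below (suc k) (s≤s k<j)) (λ k j≤k → decay (suc k) (s≤s j≤k))
∑<-geometric (suc L) zero    f _     decay = begin
  f 0 + ∑< L (f ∘ suc) ≤⟨ +-monoʳ-≤ (f 0) (∑<-geometric L 0 (f ∘ suc) (λ _ ()) (λ k _ → decay (suc k) z≤n)) ⟩
  f 0 + 2 * f 1        ≤⟨ +-monoʳ-≤ (f 0) (decay 0 z≤n) ⟩
  f 0 + f 0            ≡⟨ cong (f 0 +_) (+-identityʳ (f 0)) ⟨
  2 * f 0              ∎
  where open ≤-Reasoning

-- _C_ binds more loosely than _*_, hence (n C k) * x.
∑-allSubsets-bySize : ∀ n L (g : ℕ → ℕ) → n < L →
  ∑[ S ∈ allSubsets n ] g ∣ S ∣ ≡ ∑[ k < L ] ((n C k) * g k)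
∑-allSubsets-bySize zero    (suc L) g _ =
  sym (trans (cong ((0 C 0) * g 0 +_) (∑<-zero L)) (+-identityʳ ((0 C 0) * g 0)))
∑-allSubsets-bySize (suc n) (suc L) g (s≤s n<L) = begin
  ∑[ S ∈ allSubsets (suc n) ] g ∣ S ∣
    ≡⟨ ∑-allSubsets n (g ∘ ∣_∣) ⟩
  (∑[ S ∈ allSubsets n ] g ∣ S ∣) + (∑[ S ∈ allSubsets n ] g (suc ∣ S ∣))
    ≡⟨ cong₂ _+_ (∑-allSubsets-bySize n (suc L) g (m<n⇒m<1+n n<L))
                 (∑-allSubsets-bySize n L (g ∘ suc) n<L) ⟩
  ((n C 0) * g 0 + s₁) + s₂ ≡⟨ +-assoc ((n C 0) * g 0) s₁ s₂ ⟩
  (n C 0) * g 0 + (s₁ + s₂) ≡⟨ cong ((n C 0) * g 0 +_) (+-comm s₁ s₂) ⟩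
  (n C 0) * g 0 + (s₂ + s₁) ≡⟨ cong ((n C 0) * g 0 +_) (∑<-+ L _ _) ⟨
  (n C 0) * g 0 + (∑[ k < L ] ((n C k) * g (suc k) + (n C suc k) * g (suc k)))
    ≡⟨ cong ((n C 0) * g 0 +_) (∑<-cong L pascal) ⟩
  ∑[ k < suc L ] ((suc n C k) * g k) ∎
  where
  open ≡-Reasoning
  s₁ = ∑[ k < L ] ((n C suc k) * g (suc k))
  s₂ = ∑[ k < L ] ((n C k) * g (suc k))
  pascal : ∀ k → (n C k) * g (suc k) + (n C suc k) * g (suc k) ≡ (suc n C suc k) * g (suc k)
  pascal k = trans (sym (*-distribʳ-+ (g (suc k)) (n C k) _))
                   (cong (_* g (suc k)) (nCk+nC[k+1]≡[n+1]C[k+1] n k))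

[k+1]*nC[k+1]≤n*nCk : ∀ n k → suc k * (n C suc k) ≤ n * (n C k)
[k+1]*nC[k+1]≤n*nCk zero    k       = ≤-reflexive (*-zeroʳ (suc k))
[k+1]*nC[k+1]≤n*nCk (suc n) zero    =
  ≤-reflexive (trans (+-identityʳ _) (trans (nC1≡n (suc n)) (sym (*-identityʳ (suc n)))))
[k+1]*nC[k+1]≤n*nCk (suc n) (suc k) = begin
  suc (suc k) * (suc n C suc (suc k))  ≡⟨ cong (suc (suc k) *_) (nCk+nC[k+1]≡[n+1]C[k+1] n (suc k)) ⟨
  suc (suc k) * (C₁ + C₂)              ≡⟨ regroup k C₁ C₂ ⟩
  (suc k * C₁ + suc (suc k) * C₂) + C₁
    ≤⟨ +-mono-≤ (+-mono-≤ ([k+1]*nC[k+1]≤n*nCk n k) ([k+1]*nC[k+1]≤n*nCk n (suc k))) (m≤n+m C₁ C₀) ⟩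
  (n * C₀ + n * C₁) + (C₀ + C₁)        ≡⟨ collect n C₀ C₁ ⟩
  suc n * (C₀ + C₁)                    ≡⟨ cong (suc n *_) (nCk+nC[k+1]≡[n+1]C[k+1] n k) ⟩
  suc n * (suc n C suc k)              ∎
  where
  open ≤-Reasoning
  C₀ = n C k
  C₁ = n C suc k
  C₂ = n C suc (suc k)
  regroup : ∀ k x y → suc (suc k) * (x + y) ≡ (suc k * x + suc (suc k) * y) + x
  regroup = solve-∀
  collect : ∀ n x y → (n * x + n * y) + (x + y) ≡ suc n * (x + y)
  collect = solve-∀

monoPairs : ℕ → ℕ → ℕ
monoPairs n k = (n C k) * monoColourings n k

2^k*monoPairs-ratio : ∀ n k → 2 ^ k * (suc k * monoPairs n (suc k)) ≤ n * monoPairs n k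
2^k*monoPairs-ratio n k with suc k ≤? n
... | no  k+1≰n = ≤-trans (≤-reflexive vanishes) z≤n
  where
  vanishes : 2 ^ k * (suc k * monoPairs n (suc k)) ≡ 0
  vanishes rewrite k>n⇒nCk≡0 (≰⇒> k+1≰n) | *-zeroʳ (suc k) = *-zeroʳ (2 ^ k)
... | yes k<n = begin
  2 ^ k * (suc k * ((n C suc k) * D′))  ≡⟨ shuffle (2 ^ k) (suc k) (n C suc k) D′ ⟩
  (suc k * (n C suc k)) * (2 ^ k * D′)  ≤⟨ *-monoˡ-≤ (2 ^ k * D′) ([k+1]*nC[k+1]≤n*nCk n k) ⟩
  (n * (n C k)) * (2 ^ k * D′)          ≡⟨ cong (n * (n C k) *_) (monoColourings-suc n k k<n) ⟨
  (n * (n C k)) * monoColourings n k    ≡⟨ *-assoc n (n C k) _ ⟩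
  n * monoPairs n k                         ∎
  where
  open ≤-Reasoning
  D′ = monoColourings n (suc k)
  shuffle : ∀ p s c d → p * (s * (c * d)) ≡ (s * c) * (p * d)
  shuffle = solve-∀

monoPairs-ratio : ∀ d n k → n ≤ d * 2 ^ k → suc k * monoPairs n (suc k) ≤ d * monoPairs n k
monoPairs-ratio d n k n≤d2ᵏ = *-cancelˡ-≤ (2 ^ k) {{m^n≢0 2 k}} (begin
  2 ^ k * (suc k * monoPairs n (suc k)) ≤⟨ 2^k*monoPairs-ratio n k ⟩
  n * monoPairs n k                     ≤⟨ *-monoˡ-≤ (monoPairs n k) n≤d2ᵏ ⟩
  d * 2 ^ k * monoPairs n k             ≡⟨ swap d (2 ^ k) (monoPairs n k) ⟩
  2 ^ k * (d * monoPairs n k)           ∎)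
  where
  open ≤-Reasoning
  swap : ∀ d p l → d * p * l ≡ p * (d * l)
  swap = solve-∀

∑-monoTotalSize : ∀ n →
  ∑[ c ∈ colourings n ] monoTotalSize c ≡ ∑[ S ∈ allSubsets n ] (∣ S ∣ * #monochromatic S)
∑-monoTotalSize n = ∑-∑-filter monochromatic? (colourings n) (allSubsets n) ∣_∣

∑-monoCount : ∀ n → ∑[ c ∈ colourings n ] monoCount c ≡ ∑[ S ∈ allSubsets n ] #monochromatic S
∑-monoCount n = ∑-length-filter monochromatic? (colourings n) (allSubsets n)

module FirstMoment (n m a b : ℕ) (1≤m : 1 ≤ m) (m≤n : m ≤ n) (n<2^[1+m] : n < 2 ^ suc m)
                   (8b≤ma : 8 * b ≤ m * a) where

  surplus : ℕ → ℕ
  surplus k = ⟦ k ≟ m ⟧ * (m * a * monoColourings n k)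

  deficit : ℕ → ℕ
  deficit k = ⟦ m <? k ⟧ * (2 * b * k * monoColourings n k)

  surplus-deficit : ∀ k X → monoColourings n k ≤ X → X ≤ 2 * monoColourings n k →
                    b * k * X + surplus k ≤ m * (a + b) * X + deficit k
  surplus-deficit k X D≤X X≤2D with k ≟ m | m <? k
  ... | yes refl | yes m<m = contradiction m<m (<-irrefl refl)
  ... | yes refl | no  _   = begin
    b * k * X + 1 * (k * a * D) ≤⟨ +-monoʳ-≤ (b * k * X) (*-monoʳ-≤ 1 (*-monoʳ-≤ (k * a) D≤X)) ⟩
    b * k * X + 1 * (k * a * X) ≡⟨ collect k a b X ⟩
    k * (a + b) * X + 0         ∎
    where
    open ≤-Reasoning
    D = monoColourings n k
    collect : ∀ k a b X → b * k * X + 1 * (k * a * X) ≡ k * (a + b) * X + 0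
    collect = solve-∀
  ... | no  _    | yes m<k = begin
    b * k * X + 0           ≤⟨ +-monoˡ-≤ 0 (*-monoʳ-≤ (b * k) X≤2D) ⟩
    b * k * (2 * D) + 0     ≡⟨ regroup b k D ⟩
    1 * (2 * b * k * D)     ≤⟨ m≤n+m _ (m * (a + b) * X) ⟩
    m * (a + b) * X + 1 * (2 * b * k * D) ∎
    where
    open ≤-Reasoning
    D = monoColourings n k
    regroup : ∀ b k D → b * k * (2 * D) + 0 ≡ 1 * (2 * b * k * D)
    regroup = solve-∀
  ... | no  _    | no  m≮k = begin
    b * k * X + 0           ≤⟨ +-monoˡ-≤ 0 (*-monoˡ-≤ X (*-monoʳ-≤ b (≮⇒≥ m≮k))) ⟩
    b * m * X + 0           ≤⟨ +-monoˡ-≤ 0 (m≤m+n (b * m * X) (m * a * X)) ⟩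
    b * m * X + m * a * X + 0 ≡⟨ collect m a b X ⟩
    m * (a + b) * X + 0     ∎
    where
    open ≤-Reasoning
    collect : ∀ m a b X → b * m * X + m * a * X + 0 ≡ m * (a + b) * X + 0
    collect = solve-∀

  C*deficit-above : ∀ {k} → m < k → (n C k) * deficit k ≡ 2 * b * (k * monoPairs n k)
  C*deficit-above {k} m<k rewrite ⟦⟧-yes m<k (m <? k) = regroup (n C k) b k (monoColourings n k)
    where
    regroup : ∀ c b k D → c * (1 * (2 * b * k * D)) ≡ 2 * b * (k * (c * D))
    regroup = solve-∀

  C*deficit-below : ∀ k → k < suc m → (n C k) * deficit k ≡ 0
  C*deficit-below k (s≤s k≤m) rewrite ⟦⟧-no (≤⇒≯ k≤m) (m <? k) = *-zeroʳ (n C k)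

  C*surplus-at : (n C m) * surplus m ≡ m * a * monoPairs n m
  C*surplus-at rewrite ⟦⟧-yes refl (m ≟ m) = regroup (n C m) m a (monoColourings n m)
    where
    regroup : ∀ c m a D → c * (1 * (m * a * D)) ≡ m * a * (c * D)
    regroup = solve-∀

  C*deficit-decay : ∀ k → suc m ≤ k → 2 * ((n C suc k) * deficit (suc k)) ≤ (n C k) * deficit k
  C*deficit-decay k m<k = begin
    2 * ((n C suc k) * deficit (suc k))   ≡⟨ cong (2 *_) (C*deficit-above (m<n⇒m<1+n m<k)) ⟩
    2 * (2 * b * (suc k * monoPairs n (suc k))) ≡⟨ regroup b (suc k * monoPairs n (suc k)) ⟩
    2 * b * (2 * (suc k * monoPairs n (suc k))) ≤⟨ *-monoʳ-≤ (2 * b) (*-monoʳ-≤ 2 ratio) ⟩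
    2 * b * (2 * (1 * monoPairs n k))           ≤⟨ *-monoʳ-≤ (2 * b) (*-monoˡ-≤ (1 * monoPairs n k) 2≤k) ⟩
    2 * b * (k * (1 * monoPairs n k))           ≡⟨ cong (λ l → 2 * b * (k * l)) (*-identityˡ _) ⟩
    2 * b * (k * monoPairs n k)                 ≡⟨ C*deficit-above m<k ⟨
    (n C k) * deficit k                   ∎
    where
    open ≤-Reasoning
    2≤k : 2 ≤ k
    2≤k = ≤-trans (s≤s 1≤m) m<k
    n≤2^k : n ≤ 1 * 2 ^ k
    n≤2^k = ≤-trans (<⇒≤ n<2^[1+m]) (≤-trans (^-monoʳ-≤ 2 m<k) (≤-reflexive (sym (*-identityˡ (2 ^ k)))))
    ratio : suc k * monoPairs n (suc k) ≤ 1 * monoPairs n k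
    ratio = monoPairs-ratio 1 n k n≤2^k
    regroup : ∀ b x → 2 * (2 * b * x) ≡ 2 * b * (2 * x)
    regroup = solve-∀

  C*deficit-first≤C*surplus : 2 * ((n C suc m) * deficit (suc m)) ≤ (n C m) * surplus m
  C*deficit-first≤C*surplus = begin
    2 * ((n C suc m) * deficit (suc m))     ≡⟨ cong (2 *_) (C*deficit-above ≤-refl) ⟩
    2 * (2 * b * (suc m * monoPairs n (suc m))) ≤⟨ *-monoʳ-≤ 2 (*-monoʳ-≤ (2 * b) ratio) ⟩
    2 * (2 * b * (2 * monoPairs n m))           ≡⟨ regroup b (monoPairs n m) ⟩
    8 * b * monoPairs n m                       ≤⟨ *-monoˡ-≤ (monoPairs n m) 8b≤ma ⟩
    m * a * monoPairs n m                       ≡⟨ C*surplus-at ⟨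
    (n C m) * surplus m                     ∎
    where
    open ≤-Reasoning
    ratio : suc m * monoPairs n (suc m) ≤ 2 * monoPairs n m
    ratio = monoPairs-ratio 2 n m (<⇒≤ n<2^[1+m])
    regroup : ∀ b l → 2 * (2 * b * (2 * l)) ≡ 8 * b * l
    regroup = solve-∀

  ∑-deficit≤∑-surplus : ∑[ S ∈ allSubsets n ] deficit ∣ S ∣ ≤ ∑[ S ∈ allSubsets n ] surplus ∣ S ∣
  ∑-deficit≤∑-surplus = begin
    ∑[ S ∈ allSubsets n ] deficit ∣ S ∣          ≡⟨ ∑-allSubsets-bySize n (suc n) deficit ≤-refl ⟩
    ∑[ k < suc n ] ((n C k) * deficit k)
      ≤⟨ ∑<-geometric (suc n) (suc m) _ C*deficit-below C*deficit-decay ⟩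
    2 * ((n C suc m) * deficit (suc m))          ≤⟨ C*deficit-first≤C*surplus ⟩
    (n C m) * surplus m                          ≤⟨ term≤∑< (suc n) (λ k → (n C k) * surplus k) (s≤s m≤n) ⟩
    ∑[ k < suc n ] ((n C k) * surplus k)         ≡⟨ ∑-allSubsets-bySize n (suc n) surplus ≤-refl ⟨
    ∑[ S ∈ allSubsets n ] surplus ∣ S ∣          ∎
    where open ≤-Reasoning

  ∑-weightedSize≤∑-weightedBound :
    ∑[ S ∈ allSubsets n ] (b * ∣ S ∣ * #monochromatic S)
      ≤ ∑[ S ∈ allSubsets n ] (m * (a + b) * #monochromatic S)
  ∑-weightedSize≤∑-weightedBound = +-cancelʳ-≤ (∑ 𝒫 (surplus ∘ ∣_∣)) _ _ (begin
    ∑ 𝒫 size + ∑ 𝒫 (surplus ∘ ∣_∣)             ≡⟨ ∑-+ 𝒫 size (surplus ∘ ∣_∣) ⟨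
    ∑[ S ∈ 𝒫 ] (size S + surplus ∣ S ∣)        ≤⟨ ∑-mono 𝒫 (λ S → surplus-deficit ∣ S ∣ (#monochromatic S)
                                                  (monoColourings≤#monochromatic S) (#monochromatic≤2*monoColourings S)) ⟩
    ∑[ S ∈ 𝒫 ] (bound S + deficit ∣ S ∣)       ≡⟨ ∑-+ 𝒫 bound (deficit ∘ ∣_∣) ⟩
    ∑ 𝒫 bound + ∑ 𝒫 (deficit ∘ ∣_∣)            ≤⟨ +-monoʳ-≤ (∑ 𝒫 bound) ∑-deficit≤∑-surplus ⟩
    ∑ 𝒫 bound + ∑ 𝒫 (surplus ∘ ∣_∣)            ∎)
    where
    open ≤-Reasoning
    𝒫 = allSubsets n
    size bound : Subset n → ℕ
    size  S = b * ∣ S ∣ * #monochromatic S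
    bound S = m * (a + b) * #monochromatic S

  ∑-scaledSize≤∑-scaledCount :
    ∑[ c ∈ colourings n ] (monoTotalSize c * b) ≤ ∑[ c ∈ colourings n ] (m * (monoCount c * (a + b)))
  ∑-scaledSize≤∑-scaledCount = begin
    ∑[ c ∈ cs ] (monoTotalSize c * b)            ≡⟨ ∑-*ʳ cs b monoTotalSize ⟩
    (∑[ c ∈ cs ] monoTotalSize c) * b            ≡⟨ cong (_* b) (∑-monoTotalSize n) ⟩
    (∑[ S ∈ 𝒫 ] (∣ S ∣ * #monochromatic S)) * b  ≡⟨ ∑-*ʳ 𝒫 b _ ⟨
    ∑[ S ∈ 𝒫 ] (∣ S ∣ * #monochromatic S * b)    ≡⟨ ∑-cong 𝒫 (λ S → rotate ∣ S ∣ (#monochromatic S) b) ⟩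
    ∑[ S ∈ 𝒫 ] (b * ∣ S ∣ * #monochromatic S)    ≤⟨ ∑-weightedSize≤∑-weightedBound ⟩
    ∑[ S ∈ 𝒫 ] (m * (a + b) * #monochromatic S)  ≡⟨ ∑-*ˡ 𝒫 (m * (a + b)) #monochromatic ⟩
    m * (a + b) * (∑[ S ∈ 𝒫 ] #monochromatic S)  ≡⟨ cong (m * (a + b) *_) (∑-monoCount n) ⟨
    m * (a + b) * (∑[ c ∈ cs ] monoCount c)      ≡⟨ ∑-*ˡ cs (m * (a + b)) monoCount ⟨
    ∑[ c ∈ cs ] (m * (a + b) * monoCount c)      ≡⟨ ∑-cong cs (λ c → rearrange m a b (monoCount c)) ⟩
    ∑[ c ∈ cs ] (m * (monoCount c * (a + b)))    ∎
    where
    open ≤-Reasoning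
    𝒫  = allSubsets n
    cs = colourings n
    rotate : ∀ s x b → s * x * b ≡ b * s * x
    rotate = solve-∀
    rearrange : ∀ m a b x → m * (a + b) * x ≡ m * (x * (a + b))
    rearrange = solve-∀

  goodColouring : ∃[ c ] monoTotalSize c * b ≤ m * (monoCount c * (a + b))
  goodColouring = ∑≤∑⇒∃≤ (colourings n) _ _ nonempty ∑-scaledSize≤∑-scaledCount
    where
    nonempty : 0 < length (colourings n)
    nonempty = subst (0 <_) (sym (length-colourings n)) (m^n>0 2 (triangular n))

n<2^n : ∀ n → n < 2 ^ n
n<2^n zero    = s≤s z≤n
n<2^n (suc n) = begin-strict
  suc n         <⟨ m<m+n (suc n) (s≤s z≤n) ⟩
  suc n + 1     ≤⟨ +-mono-≤ (n<2^n n) (m^n>0 2 n) ⟩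
  2 ^ n + 2 ^ n ≡⟨ 2^+2^≡2^suc n ⟩
  2 ^ suc n     ∎
  where open ≤-Reasoning

2^-cancel-< : ∀ {x y} → 2 ^ x < 2 ^ y → x < y
2^-cancel-< {x} {y} 2^x<2^y with x <? y
... | yes x<y = x<y
... | no  x≮y = contradiction 2^x<2^y (≤⇒≯ (^-monoʳ-≤ 2 (≮⇒≥ x≮y)))

log₂-bracket : ∀ n → 1 ≤ n → ∃[ m ] 2 ^ m ≤ n × n < 2 ^ suc m
log₂-bracket (suc zero)    _ = 0 , s≤s z≤n , s≤s (s≤s z≤n)
log₂-bracket (suc (suc n)) _ with log₂-bracket (suc n) (s≤s z≤n)
... | m , lower , upper with suc (suc n) <? 2 ^ suc m
...   | yes upper′ = m , m≤n⇒m≤1+n lower , upper′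
...   | no  ¬upper′ =
  suc m , ≮⇒≥ ¬upper′ , ≤-<-trans upper (m<m+n (2 ^ suc m) (≤-trans (m^n>0 2 (suc m)) (m≤m+n _ 0)))

2^-≤-^ : ∀ m {n} x y → 2 ^ m ≤ n → x ≤ m * y → 2 ^ x ≤ n ^ y
2^-≤-^ m {n} x y 2^m≤n x≤my = begin
  2 ^ x       ≤⟨ ^-monoʳ-≤ 2 x≤my ⟩
  2 ^ (m * y) ≡⟨ ^-*-assoc 2 m y ⟨
  (2 ^ m) ^ y ≤⟨ ^-monoˡ-≤ y 2^m≤n ⟩
  n ^ y       ∎
  where open ≤-Reasoning

sparseColouring : ∀ n m a b → 1 ≤ a → 1 ≤ b → 2 ^ m ≤ n → n < 2 ^ suc m → 8 * b ≤ m →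
                  ∃[ c ] 2 ^ (monoTotalSize {n} c * b) ≤ n ^ (monoCount c * (a + b))
sparseColouring n m a b 1≤a 1≤b 2^m≤n n<2^[1+m] 8b≤m =
  let c , bound = FirstMoment.goodColouring n m a b 1≤m m≤n n<2^[1+m] 8b≤ma
  in  c , 2^-≤-^ m (monoTotalSize c * b) (monoCount c * (a + b)) 2^m≤n bound
  where
  1≤m : 1 ≤ m
  1≤m = ≤-trans (≤-trans (s≤s z≤n) (*-monoʳ-≤ 8 1≤b)) 8b≤m
  m≤n : m ≤ n
  m≤n = ≤-trans (<⇒≤ (n<2^n m)) 2^m≤n
  8b≤ma : 8 * b ≤ m * a
  8b≤ma = ≤-trans 8b≤m (m≤m*n m a {{>-nonZero 1≤a}})

1≤∣↥ε∣ : ∀ ε → 0ℚ ℚ.< ε → 1 ≤ ℤ.∣ ↥ ε ∣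
1≤∣↥ε∣ (mkℚ (ℤ.+ suc _) _ _) _   = s≤s z≤n
1≤∣↥ε∣ (mkℚ (ℤ.+ 0)     _ _) 0<ε with () ← positive 0<ε
1≤∣↥ε∣ (mkℚ ℤ.-[1+ _ ]  _ _) 0<ε with () ← positive 0<ε

mainTheorem9 : (ε : ℚ) → 0ℚ ℚ.< ε →
    ∃[ n₀ ] ((n : ℕ) → n₀ ≤ n → Σ (Colouring n) (AvgMonoSizeAtMost1+εLog₂ ε))
mainTheorem9 ε 0<ε = 2 ^ (8 * b) , colouring
  where
  a = ℤ.∣ ↥ ε ∣
  b = ↧ₙ ε
  colouring : (n : ℕ) → 2 ^ (8 * b) ≤ n → Σ (Colouring n) (AvgMonoSizeAtMost1+εLog₂ ε)
  colouring n 2^8b≤n with log₂-bracket n (≤-trans (m^n>0 2 (8 * b)) 2^8b≤n)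
  ... | m , 2^m≤n , n<2^[1+m] =
    sparseColouring n m a b (1≤∣↥ε∣ ε 0<ε) (s≤s z≤n) 2^m≤n n<2^[1+m]
                    (s≤s⁻¹ (2^-cancel-< (≤-<-trans 2^8b≤n n<2^[1+m])))
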